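{- Let $\mathcal{M}$ be a relational structure with domain $M$ and $\mathcal{L}$ a logic such that the $\mathcal{L}$-theory of $\mathcal{M}$ is decidable. Then the nonemptiness problem for $\mathcal{M}$-$\mathcal{L}$-automata on finite words, as well as for $\mathcal{M}$-$\mathcal{L}$-Büchi automata, is decidable.
   Context: An $\mathcal{M}$-$\mathcal{L}$-(Büchi) automaton over $M^n$ is $\mathcal{B}=(Q,M^n,q_0,\Delta,F)$ with finite state set $Q$, initial state $q_0$, accepting set $F\subseteq Q$, and finite transition relation $\Delta\subseteq Q\times\Phi_n\times Q$, where $\Phi_n$ is the set of $\mathcal{L}$-formulas (over the signature of $\mathcal{M}$) with $n$ free variables. A run on a (finite or infinite) word over $M^n$ with letters $(a_1(i),\dots,a_n(i))$ is a state sequence starting in $q_0$ such that for each position $i$ there is a transition $(\rho(i),\phi,\rho(i+1))\in\Delta$ with $\mathcal{M}\models\phi[a_1(i),\dots,a_n(i)]$. On finite words, a word is accepted if some run ends in $F$; on $\omega$-words (Büchi automaton), a word is accepted if some run visits $F$ infinitely often. The nonemptiness problem asks, given such an automaton, whether it accepts some word. -}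

module Defs where

open import Data.Nat using (ℕ; zero; suc; _≤_)
open import Data.Fin using (Fin; inject₁) renaming (zero to fzero; suc to fsuc)
open import Data.Fin.Subset using (Subset; _∈_)
open import Data.Vec using (Vec; _∷_; [])
open import Data.List using (List; length; lookup)
import Data.List.Membership.Propositional as LMem
open import Data.Product using (Σ; ∃; _×_; _,_)
open import Function.Bundles using (_⇔_)
open import Relation.Binary.PropositionalEquality using (_≡_)
open import Relation.Nullary using (Dec)

-- The only structural assumption on the logic is closure under existential
-- quantification of a free variable (as in FO, MSO, and their extensions).
record StructureWithLogic : Set₁ where
  field
    M    : Set
    Φ    : ℕ → Set                              -- 𝓛-formulas with n free variables
    _⊨_  : ∀ {n} → Vec M n → Φ n → Set
    ∃'   : ∀ {n} → Φ (suc n) → Φ n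
    ∃'-sem : ∀ {n} (φ : Φ (suc n)) (as : Vec M n) →
             (as ⊨ ∃' φ) ⇔ (Σ M λ a → (a ∷ as) ⊨ φ)

  Sentence : Set
  Sentence = Φ 0

  Holds : Sentence → Set
  Holds σ = [] ⊨ σ

  DecidableTheory : Set
  DecidableTheory = (σ : Sentence) → Dec (Holds σ)

module _ (S : StructureWithLogic) where
  open StructureWithLogic S

  record Automaton (n : ℕ) : Set where
    field
      k  : ℕ
      q₀ : Fin k
      Δ  : List (Fin k × Φ n × Fin k)
      F  : Subset k

  module _ {n : ℕ} (B : Automaton n) where
    open Automaton B

    Step : Fin k → Vec M n → Fin k → Set
    Step p a q = Σ (Φ n) λ φ → ((p , φ , q) LMem.∈ Δ) × (a ⊨ φ)

    IsRunFin : (w : List (Vec M n)) → (Fin (suc (length w)) → Fin k) → Set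
    IsRunFin w ρ = (ρ fzero ≡ q₀) ×
                   ((i : Fin (length w)) → Step (ρ (inject₁ i)) (lookup w i) (ρ (fsuc i)))

    AcceptsFin : List (Vec M n) → Set
    AcceptsFin w = Σ (Fin (suc (length w)) → Fin k) λ ρ →
                   IsRunFin w ρ × (ρ (Data.Fin.fromℕ (length w)) ∈ F)

    IsRunω : (ℕ → Vec M n) → (ℕ → Fin k) → Set
    IsRunω w ρ = (ρ 0 ≡ q₀) × ((i : ℕ) → Step (ρ i) (w i) (ρ (suc i)))

    AcceptsBüchi : (ℕ → Vec M n) → Set
    AcceptsBüchi w = Σ (ℕ → Fin k) λ ρ →
                     IsRunω w ρ × ((i : ℕ) → Σ ℕ λ j → (i ≤ j) × (ρ j ∈ F))

    NonemptyFin : Set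
    NonemptyFin = Σ (List (Vec M n)) AcceptsFin

    NonemptyBüchi : Set
    NonemptyBüchi = Σ (ℕ → Vec M n) AcceptsBüchi

-- The existential closure of a transition formula is a sentence, so a decidable
-- theory tells which transitions of an automaton can fire on some letter. As the
-- letters read at different positions are independent, an automaton is nonempty
-- iff its finite graph of enabled transitions has an accepting state reachable
-- from the initial one (finite words), resp. a reachable accepting state lying on
-- a cycle (Büchi). Reachability in a graph with k vertices is decidable because,
-- by the pigeonhole principle, any walk can be shortened to one of length at most k.
module Submission where

open import Defs
open import Data.Nat using (ℕ; zero; suc; _+_; _∸_; _≤_; _<_; _≤?_; s≤s)
open import Data.Nat.Properties
  using (≰⇒>; +-identityʳ; m<n⇒m<1+n; n<1+n; <-trans; m≤n⇒m<n∨m≡n; +-suc; m≤m+n; +-monoˡ-<;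
         m+[n∸m]≡n; m≤n⇒∃[o]m+o≡n)
open import Data.Nat.Induction using (<-rec)
open import Data.Fin using (Fin; toℕ; fromℕ; fromℕ<; inject₁) renaming (zero to fzero; suc to fsuc)
import Data.Fin.Properties as Fin
open import Data.Fin.Subset using () renaming (_∈_ to _∈ₛ_)
open import Data.Fin.Subset.Properties using (_∈?_)
open import Data.Vec using (Vec; []; _∷_)
open import Data.List using (List; length; lookup) renaming ([] to []ₗ; _∷_ to _∷ₗ_)
open import Data.List.Relation.Unary.Any using (any?)
open import Data.List.Membership.Propositional using (_∈_; find; lose)
open import Data.Product using (Σ; ∃; ∃₂; _×_; _,_; proj₁; proj₂)
open import Data.Sum using (inj₁; inj₂)
open import Function.Base using (_∘_)
open import Function.Bundles using (Equivalence)
open import Relation.Binary.PropositionalEquality using (_≡_; refl; sym; trans; cong; subst)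
open import Relation.Nullary using (Dec; yes; no)
open import Relation.Nullary.Decidable using (map′; _×-dec_)
open import Relation.Unary using (Decidable)

module StrictlyIncreasingWitnesses {Q : ℕ → Set} (often : ∀ i → Σ ℕ λ j → i ≤ j × Q j) where

  visit : ℕ → ℕ
  visit zero    = proj₁ (often 0)
  visit (suc t) = proj₁ (often (suc (visit t)))

  visit-satisfies : ∀ t → Q (visit t)
  visit-satisfies zero    = proj₂ (proj₂ (often 0))
  visit-satisfies (suc t) = proj₂ (proj₂ (often (suc (visit t))))

  visit-step : ∀ t → visit t < visit (suc t)
  visit-step t = proj₁ (proj₂ (often (suc (visit t))))

  visit-mono : ∀ {t u} → t < u → visit t < visit u
  visit-mono {t} {suc u} (s≤s t≤u) with m≤n⇒m<n∨m≡n t≤u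
  ... | inj₁ t<u  = <-trans (visit-mono t<u) (visit-step u)
  ... | inj₂ refl = visit-step u

module Walks {k : ℕ} (Edge : Fin k → Fin k → Set) where

  infixr 5 _∷_ _++_

  data Walk : ℕ → Fin k → Fin k → Set where
    []  : ∀ {p} → Walk 0 p p
    _∷_ : ∀ {m p r q} → Edge p r → Walk m r q → Walk (suc m) p q

  _++_ : ∀ {a b p r q} → Walk a p r → Walk b r q → Walk (a + b) p q
  []      ++ v = v
  (e ∷ w) ++ v = e ∷ (w ++ v)

  vertex : ∀ {m p q} → Walk m p q → Fin (suc m) → Fin k
  vertex {p = p} w       fzero    = p
  vertex         (e ∷ w) (fsuc i) = vertex w i

  take : ∀ {m p q} (w : Walk m p q) (i : Fin (suc m)) → Walk (toℕ i) p (vertex w i)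
  take w       fzero    = []
  take (e ∷ w) (fsuc i) = e ∷ take w i

  drop : ∀ {m p q} (w : Walk m p q) (i : Fin (suc m)) → Walk (m ∸ toℕ i) (vertex w i) q
  drop w       fzero    = w
  drop (e ∷ w) (fsuc i) = drop w i

  Reachable : Fin k → Fin k → Set
  Reachable p q = Σ ℕ λ m → Walk m p q

  Reachable⁺ : Fin k → Fin k → Set
  Reachable⁺ p q = Σ ℕ λ m → Walk (suc m) p q

  ShortWalk : Fin k → Fin k → Set
  ShortWalk p q = Σ (Fin (suc k)) λ m → Walk (toℕ m) p q

  cutLoop : ∀ {m p q} → k < m → Walk m p q → Σ ℕ λ m′ → m′ < m × Walk m′ p q
  cutLoop {m} {q = q} k<m w with Fin.pigeonhole (m<n⇒m<1+n k<m) (vertex w)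
  ... | i , j , i<j , same =
    toℕ i + (m ∸ toℕ j) , shorter ,
    take w i ++ subst (λ r → Walk (m ∸ toℕ j) r q) (sym same) (drop w j)
    where
      shorter : toℕ i + (m ∸ toℕ j) < m
      shorter = subst (toℕ i + (m ∸ toℕ j) <_) (m+[n∸m]≡n (Fin.toℕ≤pred[n] j))
                      (+-monoˡ-< (m ∸ toℕ j) i<j)

  shorten : ∀ {m p q} → Walk m p q → ShortWalk p q
  shorten {m} = <-rec (λ m → ∀ {p q} → Walk m p q → ShortWalk p q) go m
    where
      go : ∀ m → (∀ {m′} → m′ < m → ∀ {p q} → Walk m′ p q → ShortWalk p q) →
           ∀ {p q} → Walk m p q → ShortWalk p q
      go m shorten< w with m ≤? k
      ... | yes m≤k = fromℕ< (s≤s m≤k) ,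
                      subst (λ l → Walk l _ _) (sym (Fin.toℕ-fromℕ< (s≤s m≤k))) w
      ... | no m≰k with cutLoop (≰⇒> m≰k) w
      ...   | _ , m′<m , w′ = shorten< m′<m w′

  Lasso : (Fin k → Set) → Fin k → Set
  Lasso P p = Σ (Fin k) λ f → P f × Reachable p f × Reachable⁺ f f

  IsInfinitePath : Fin k → (ℕ → Fin k) → Set
  IsInfinitePath p ρ = ρ 0 ≡ p × (∀ i → Edge (ρ i) (ρ (suc i)))

  RecurrentPath : (Fin k → Set) → Fin k → Set
  RecurrentPath P p = Σ (ℕ → Fin k) λ ρ →
                      IsInfinitePath p ρ × (∀ i → Σ ℕ λ j → i ≤ j × P (ρ j))

  -- The infinite path prefix · cycle · cycle · ⋯, generated by the state machine
  -- whose states are the nonempty walks to f still to be traversed.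
  module Unroll {c f} (cycle : Walk (suc c) f f) where

    Pending : Set
    Pending = Σ (Fin k) λ r → Σ ℕ λ m → Walk (suc m) r f

    advance : Pending → Pending
    advance (_ , zero  , _ ∷ [])          = f , c , cycle
    advance (_ , suc m , _∷_ {r = r} _ w) = r , m , w

    firstEdge : ∀ s → Edge (proj₁ s) (proj₁ (advance s))
    firstEdge (_ , zero  , e ∷ []) = e
    firstEdge (_ , suc m , e ∷ w)  = e

    orbit : Pending → ℕ → Pending
    orbit s zero    = s
    orbit s (suc i) = orbit (advance s) i

    orbit-edge : ∀ s i → Edge (proj₁ (orbit s i)) (proj₁ (orbit s (suc i)))
    orbit-edge s zero    = firstEdge s
    orbit-edge s (suc i) = orbit-edge (advance s) i

    orbit-+ : ∀ s i d → orbit s (i + d) ≡ orbit (orbit s i) d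
    orbit-+ s zero    d = refl
    orbit-+ s (suc i) d = orbit-+ (advance s) i d

    orbit-returns : ∀ {r m} (w : Walk (suc m) r f) → proj₁ (orbit (r , m , w) (suc m)) ≡ f
    orbit-returns {m = zero}  (_ ∷ []) = refl
    orbit-returns {m = suc m} (_ ∷ w)  = orbit-returns w

    start : ∀ {a p} → Walk a p f → Σ Pending λ s → proj₁ s ≡ p
    start []      = (f , c , cycle) , refl
    start (e ∷ w) = (_ , _ , e ∷ w) , refl

    returnsInfinitelyOften : ∀ s i → Σ ℕ λ j → i ≤ j × proj₁ (orbit s j) ≡ f
    returnsInfinitelyOften s i =
      i + suc len , m≤m+n i (suc len) ,
      trans (cong proj₁ (orbit-+ s i (suc len))) (orbit-returns (proj₂ (proj₂ (orbit s i))))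
      where len = proj₁ (proj₂ (orbit s i))

  lasso⇒recurrentPath : ∀ {P p} → Lasso P p → RecurrentPath P p
  lasso⇒recurrentPath {P} (f , Pf , (_ , prefix) , (_ , cycle))
    with Unroll.start cycle prefix
  ... | s₀ , s₀-source =
    (λ i → proj₁ (orbit s₀ i)) , (s₀-source , orbit-edge s₀) , visitsP
    where
      open Unroll cycle
      visitsP : ∀ i → Σ ℕ λ j → i ≤ j × P (proj₁ (orbit s₀ j))
      visitsP i with returnsInfinitelyOften s₀ i
      ... | j , i≤j , at-f = j , i≤j , subst P (sym at-f) Pf

  -- Among the first k + 1 visits of P, two are at the same vertex.
  recurrentPath⇒lasso : ∀ {P p} → RecurrentPath P p → Lasso P p
  recurrentPath⇒lasso {P} {p} (ρ , (ρ₀ , edge) , often) =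
    closeLoop (Fin.pigeonhole (n<1+n k) (λ t → ρ (visit (toℕ t))))
    where
      open StrictlyIncreasingWitnesses often

      segment : ∀ i d → Walk d (ρ i) (ρ (i + d))
      segment i zero    = subst (λ j → Walk 0 (ρ i) (ρ j)) (sym (+-identityʳ i)) []
      segment i (suc d) = subst (λ j → Walk (suc d) (ρ i) (ρ j)) (sym (+-suc i d))
                                (edge i ∷ segment (suc i) d)

      closeLoop : (∃₂ λ t u → toℕ t < toℕ u × ρ (visit (toℕ t)) ≡ ρ (visit (toℕ u))) → Lasso P p
      closeLoop (t , u , t<u , same) with m≤n⇒∃[o]m+o≡n (visit-mono t<u)
      ... | d , gap =
        ρ (visit (toℕ t)) , visit-satisfies (toℕ t) ,
        (visit (toℕ t) , subst (λ r → Walk _ r _) ρ₀ (segment 0 (visit (toℕ t)))) ,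
        (d , edge (visit (toℕ t)) ∷ subst (Walk d (ρ (suc (visit (toℕ t))))) closes (segment _ d))
        where
          closes : ρ (suc (visit (toℕ t)) + d) ≡ ρ (visit (toℕ t))
          closes = trans (cong ρ gap) (sym same)

  module Decide (edge? : ∀ p q → Dec (Edge p q)) where

    walk? : ∀ m p q → Dec (Walk m p q)
    walk? zero p q with p Fin.≟ q
    ... | yes refl = yes []
    ... | no p≢q   = no λ { [] → p≢q refl }
    walk? (suc m) p q =
      map′ (λ { (r , e , w) → e ∷ w }) (λ { (e ∷ w) → _ , e , w })
           (Fin.any? λ r → edge? p r ×-dec walk? m r q)

    reachable? : ∀ p q → Dec (Reachable p q)
    reachable? p q =
      map′ (λ { (m , w) → toℕ m , w }) (λ { (m , w) → shorten w })
           (Fin.any? λ m → walk? (toℕ m) p q)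

    reachable⁺? : ∀ p q → Dec (Reachable⁺ p q)
    reachable⁺? p q =
      map′ (λ { (r , e , m , w) → m , e ∷ w }) (λ { (m , e ∷ w) → _ , e , m , w })
           (Fin.any? λ r → edge? p r ×-dec reachable? r q)

    lasso? : ∀ {P} → Decidable P → ∀ p → Dec (Lasso P p)
    lasso? P? p = Fin.any? λ f → P? f ×-dec reachable? p f ×-dec reachable⁺? f f

module _ (S : StructureWithLogic) where
  open StructureWithLogic S

  Satisfiable : ∀ {n} → Φ n → Set
  Satisfiable {n} φ = Σ (Vec M n) λ as → as ⊨ φ

  ∃-closure : ∀ {n} → Φ n → Sentence
  ∃-closure {zero}  φ = φ
  ∃-closure {suc n} φ = ∃-closure (∃' φ)

  ∃-closure-sound : ∀ {n} (φ : Φ n) → Holds (∃-closure φ) → Satisfiable φ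
  ∃-closure-sound {zero}  φ h = [] , h
  ∃-closure-sound {suc n} φ h with ∃-closure-sound (∃' φ) h
  ... | as , as⊨∃φ with Equivalence.to (∃'-sem φ as) as⊨∃φ
  ...   | a , a∷as⊨φ = a ∷ as , a∷as⊨φ

  ∃-closure-complete : ∀ {n} (φ : Φ n) → Satisfiable φ → Holds (∃-closure φ)
  ∃-closure-complete {zero}  φ ([] , h) = h
  ∃-closure-complete {suc n} φ (a ∷ as , a∷as⊨φ) =
    ∃-closure-complete (∃' φ) (as , Equivalence.from (∃'-sem φ as) (a , a∷as⊨φ))

  satisfiable? : DecidableTheory → ∀ {n} (φ : Φ n) → Dec (Satisfiable φ)
  satisfiable? thy φ = map′ (∃-closure-sound φ) (∃-closure-complete φ) (thy (∃-closure φ))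

  module _ {n : ℕ} (B : Automaton S n) where
    open Automaton B

    Enabled : Fin k → Fin k → Set
    Enabled p q = Σ (Vec M n) λ a → Step S B p a q

    open Walks Enabled

    enabled? : DecidableTheory → ∀ p q → Dec (Enabled p q)
    enabled? thy p q =
      map′ (λ match → fromMatch (find match))
           (λ { (a , φ , t∈Δ , a⊨φ) → lose t∈Δ (refl , refl , a , a⊨φ) })
           (any? matches? Δ)
      where
        Matches : Fin k × Φ n × Fin k → Set
        Matches (p′ , φ , q′) = p′ ≡ p × q′ ≡ q × Satisfiable φ

        matches? : Decidable Matches
        matches? (p′ , φ , q′) = p′ Fin.≟ p ×-dec q′ Fin.≟ q ×-dec satisfiable? thy φ

        fromMatch : ∃ (λ t → t ∈ Δ × Matches t) → Enabled p q
        fromMatch ((_ , φ , _) , t∈Δ , refl , refl , a , a⊨φ) = a , φ , t∈Δ , a⊨φ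

    word : ∀ {m p q} → Walk m p q → List (Vec M n)
    word []            = []ₗ
    word ((a , _) ∷ w) = a ∷ₗ word w

    states : ∀ {m p q} (w : Walk m p q) → Fin (suc (length (word w))) → Fin k
    states {p = p} w       fzero    = p
    states         (_ ∷ w) (fsuc i) = states w i

    states-end : ∀ {m p q} (w : Walk m p q) → states w (fromℕ (length (word w))) ≡ q
    states-end []      = refl
    states-end (_ ∷ w) = states-end w

    states-step : ∀ {m p q} (w : Walk m p q) (i : Fin (length (word w))) →
                  Step S B (states w (inject₁ i)) (lookup (word w) i) (states w (fsuc i))
    states-step ((_ , step) ∷ w) fzero    = step
    states-step (_ ∷ w)          (fsuc i) = states-step w i

    runWalk : (w : List (Vec M n)) (ρ : Fin (suc (length w)) → Fin k) →
              (∀ i → Step S B (ρ (inject₁ i)) (lookup w i) (ρ (fsuc i))) →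
              Walk (length w) (ρ fzero) (ρ (fromℕ (length w)))
    runWalk []ₗ       ρ steps = []
    runWalk (a ∷ₗ w) ρ steps =
      (a , steps fzero) ∷ runWalk w (λ i → ρ (fsuc i)) (λ i → steps (fsuc i))

    ReachesAccepting : Set
    ReachesAccepting = Σ (Fin k) λ f → f ∈ₛ F × Reachable q₀ f

    reachesAccepting⇒nonemptyFin : ReachesAccepting → NonemptyFin S B
    reachesAccepting⇒nonemptyFin (f , f∈F , _ , w) =
      word w , states w , (refl , states-step w) , subst (_∈ₛ F) (sym (states-end w)) f∈F

    nonemptyFin⇒reachesAccepting : NonemptyFin S B → ReachesAccepting
    nonemptyFin⇒reachesAccepting (w , ρ , (ρ₀ , steps) , accepting) =
      ρ (fromℕ (length w)) , accepting ,
      length w , subst (λ p → Walk _ p _) ρ₀ (runWalk w ρ steps)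

    recurrentPath⇒nonemptyBüchi : RecurrentPath (_∈ₛ F) q₀ → NonemptyBüchi S B
    recurrentPath⇒nonemptyBüchi (ρ , (ρ₀ , enabled) , often) =
      (λ i → proj₁ (enabled i)) , ρ , (ρ₀ , λ i → proj₂ (enabled i)) , often

    nonemptyBüchi⇒recurrentPath : NonemptyBüchi S B → RecurrentPath (_∈ₛ F) q₀
    nonemptyBüchi⇒recurrentPath (w , ρ , (ρ₀ , steps) , often) =
      ρ , (ρ₀ , λ i → w i , steps i) , often

    nonemptyFin? : DecidableTheory → Dec (NonemptyFin S B)
    nonemptyFin? thy =
      map′ reachesAccepting⇒nonemptyFin nonemptyFin⇒reachesAccepting
           (Fin.any? λ f → f ∈? F ×-dec reachable? q₀ f)
      where open Decide (enabled? thy)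

    nonemptyBüchi? : DecidableTheory → Dec (NonemptyBüchi S B)
    nonemptyBüchi? thy =
      map′ (recurrentPath⇒nonemptyBüchi ∘ lasso⇒recurrentPath)
           (recurrentPath⇒lasso ∘ nonemptyBüchi⇒recurrentPath)
           (lasso? (_∈? F) q₀)
      where open Decide (enabled? thy)

proposition3p2 : (S : StructureWithLogic) →
    StructureWithLogic.DecidableTheory S →
    ((n : ℕ) (B : Automaton S n) → Dec (NonemptyFin S B))
    × ((n : ℕ) (B : Automaton S n) → Dec (NonemptyBüchi S B))
proposition3p2 S thy = (λ n B → nonemptyFin? S B thy) , (λ n B → nonemptyBüchi? S B thy)
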